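{- If $G=(X,Y,E)$ is a complete bipartite graph, then the minimum imbalance of $G$ is $$I(G)=|X|\cdot|Y|+(|X|\bmod 2)\cdot(|Y|\bmod 2).$$
   Context: All graphs are finite, simple, undirected and connected. An ordering of a finite set $V$ is a bijection $\sigma:V\to\{1,\dots,|V|\}$; $u<_\sigma v$ means $\sigma(u)<\sigma(v)$. For a graph $G=(V,E)$ and ordering $\sigma$, $I(v,\sigma,G)=\big|\,|\{u\in N(v): u<_\sigma v\}|-|\{u\in N(v): u>_\sigma v\}|\,\big|$ ($N(v)$ the neighbourhood of $v$), $I(\sigma,G)=\sum_{v\in V}I(v,\sigma,G)$, and $I(G)=\min_\sigma I(\sigma,G)$ over all orderings of $V$. -}

module Defs where

open import Data.Nat using (ℕ; _+_; _*_; _%_; ∣_-_∣; _≤_)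
open import Data.Bool using (Bool; true; false; _∧_; not)
import Data.Bool
open import Data.Fin using (Fin; _<?_)
open import Data.Nat.ListAction using (sum)
open import Data.List using (List; map; filter; length; allFin)
open import Data.Fin.Permutation using (Permutation′; _⟨$⟩ʳ_)
open import Data.Product using (Σ; _×_; ∃)
open import Relation.Binary.PropositionalEquality using (_≡_)
open import Relation.Nullary using (¬_)
open import Relation.Nullary.Decidable using (⌊_⌋)

record Graph (n : ℕ) : Set where
  field
    Adj   : Fin n → Fin n → Bool
    sym   : ∀ u v → Adj u v ≡ Adj v u
    irrefl : ∀ v → Adj v v ≡ false
open Graph public

data Walk {n : ℕ} (G : Graph n) : Fin n → Fin n → Set where
  here : ∀ {v} → Walk G v v
  step : ∀ {u w v} → Adj G u w ≡ true → Walk G w v → Walk G u v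

Connected : {n : ℕ} → Graph n → Set
Connected {n} G = ∀ (u v : Fin n) → Walk G u v

Ordering : ℕ → Set
Ordering n = Permutation′ n

countFin : {n : ℕ} → (Fin n → Bool) → ℕ
countFin {n} p = length (filter (λ v → p v Data.Bool.≟ true) (allFin n))

before : {n : ℕ} → Graph n → Ordering n → Fin n → ℕ
before G σ v = countFin (λ u → Adj G v u ∧ ⌊ (σ ⟨$⟩ʳ u) <? (σ ⟨$⟩ʳ v) ⌋)

after : {n : ℕ} → Graph n → Ordering n → Fin n → ℕ
after G σ v = countFin (λ u → Adj G v u ∧ ⌊ (σ ⟨$⟩ʳ v) <? (σ ⟨$⟩ʳ u) ⌋)

vertexImbalance : {n : ℕ} → Graph n → Ordering n → Fin n → ℕ
vertexImbalance G σ v = ∣ before G σ v - after G σ v ∣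

imbalance : {n : ℕ} → Graph n → Ordering n → ℕ
imbalance {n} G σ = sum (map (vertexImbalance G σ) (allFin n))

MinImbalance : {n : ℕ} → Graph n → ℕ → Set
MinImbalance {n} G m =
  (Σ (Ordering n) λ σ → imbalance G σ ≡ m) × (∀ (σ : Ordering n) → m ≤ imbalance G σ)

IsCompleteBipartite : {n : ℕ} → Graph n → (Fin n → Bool) → Set
IsCompleteBipartite G inX =
  (∀ u v → Adj G u v ≡ true → ¬ (inX u ≡ inX v)) ×
  (∀ u v → ¬ (inX u ≡ inX v) → Adj G u v ≡ true)

-- A vertex of K_{a,b} is adjacent exactly to the other side, so an ordering only
-- matters through its word of sides, and a vertex's imbalance is |B - A| for B / A
-- the numbers of opposite-side letters before / after it.  Cutting the word into
-- P | S and charging |B - A| ≥ A - B on P and |B - A| ≥ B - A on S, pairs inside P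
-- or inside S cancel and every X–Y pair across the cut contributes 2.  Cutting at
-- the middle X (for odd a: just before or just after it, whichever is better) gives
-- the bound a b + (a mod 2)(b mod 2), and a word symmetric about its middle attains it.
module Submission where

open import Data.Bool using (Bool; true; false; not; _∧_; _xor_)
import Data.Bool as Bool
open import Data.Bool.Properties using (∧-comm; ¬-not)
open import Data.Fin using (Fin; zero; suc; _<?_; punchIn; cast)
open import Data.Fin.Permutation using (Permutation′; _⟨$⟩ʳ_; _⟨$⟩ˡ_; flip; inverseʳ; insert; insert-punchIn)
  renaming (id to idₚ)
open import Data.List using (List; []; _∷_; _++_; [_]; length; tabulate; lookup; filter; map)
open import Data.List.Properties using (++-assoc; tabulate-cong; length-tabulate)
open import Data.Nat using (ℕ; zero; suc; pred; _+_; _*_; _%_; ∣_-_∣; _≤_; _<_; s≤s; z<s; s≤s⁻¹; s<s; s<s⁻¹)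
open import Data.Nat.DivMod using (m%n<n)
import Data.Nat.ListAction as ListAction
open import Data.Nat.Properties
  using ( +-identityʳ; +-suc; +-assoc; +-comm; *-suc; *-zeroʳ; +-cancelˡ-≡; suc-injective
        ; ∣-∣-identityʳ; ∣-∣-triangle; ∣m+n-m+o∣≡∣n-o∣
        ; ≤-reflexive; ≤-trans; +-mono-≤; +-monoˡ-≤; +-monoʳ-≤; m≤m+n; m<n+m; <-cmp; module ≤-Reasoning
        ; +-commutativeSemigroup; +-0-commutativeMonoid )
open import Data.Nat.Tactic.RingSolver using (solve-∀)
open import Data.Product using (∃; ∃₂; _×_; _,_; proj₁; proj₂)
open import Data.Sum using (_⊎_; inj₁; inj₂; [_,_]′)
open import Function using (_∘_)
open import Relation.Binary.Definitions using (tri<; tri≈; tri>)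
open import Relation.Binary.PropositionalEquality hiding ([_])
open import Relation.Nullary using (yes; no; contradiction)
open import Relation.Nullary.Decidable using (⌊_⌋)

open import Defs hiding (sym)
open import Algebra.Properties.CommutativeSemigroup +-commutativeSemigroup using (x∙yz≈y∙xz; xy∙z≈x∙zy)
open import Algebra.Properties.CommutativeMonoid.Sum +-0-commutativeMonoid
  using (sum-syntax; sum-cong-≗; sum-remove; ∑-permute; sum-replicate-zero)

-- A word lists the sides (true = X, false = Y) of the vertices of K_{a,b} in order.
#X #Y : List Bool → ℕ
#X []          = 0
#X (true  ∷ L) = suc (#X L)
#X (false ∷ L) = #X L
#Y []          = 0
#Y (true  ∷ L) = #Y L
#Y (false ∷ L) = suc (#Y L)

#X-++ : ∀ P S → #X (P ++ S) ≡ #X P + #X S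
#X-++ []          S = refl
#X-++ (true  ∷ P) S = cong suc (#X-++ P S)
#X-++ (false ∷ P) S = #X-++ P S

#Y-++ : ∀ P S → #Y (P ++ S) ≡ #Y P + #Y S
#Y-++ []          S = refl
#Y-++ (true  ∷ P) S = #Y-++ P S
#Y-++ (false ∷ P) S = cong suc (#Y-++ P S)

length≡#X+#Y : ∀ L → length L ≡ #X L + #Y L
length≡#X+#Y []          = refl
length≡#X+#Y (true  ∷ L) = cong suc (length≡#X+#Y L)
length≡#X+#Y (false ∷ L) = trans (cong suc (length≡#X+#Y L)) (sym (+-suc (#X L) (#Y L)))

#X-∷ʳ-true : ∀ L → #X (L ++ [ true ]) ≡ suc (#X L)
#X-∷ʳ-true L = trans (#X-++ L [ true ]) (+-comm (#X L) 1)

#Y-∷ʳ-true : ∀ L → #Y (L ++ [ true ]) ≡ #Y L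
#Y-∷ʳ-true L = trans (#Y-++ L [ true ]) (+-identityʳ (#Y L))

#X-∷ʳ-false : ∀ L → #X (L ++ [ false ]) ≡ #X L
#X-∷ʳ-false L = trans (#X-++ L [ false ]) (+-identityʳ (#X L))

#Y-∷ʳ-false : ∀ L → #Y (L ++ [ false ]) ≡ suc (#Y L)
#Y-∷ʳ-false L = trans (#Y-++ L [ false ]) (+-comm (#Y L) 1)

-- wordImbalance′ x y L u v is the imbalance of the vertices of L inside the
-- word Pre ++ L ++ Suf, where Pre has x X's and y Y's and Suf has u X's and v Y's.
wordImbalance′ : ℕ → ℕ → List Bool → ℕ → ℕ → ℕ
wordImbalance′ x y []          u v = 0
wordImbalance′ x y (true  ∷ L) u v = ∣ y - #Y L + v ∣ + wordImbalance′ (suc x) y L u v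
wordImbalance′ x y (false ∷ L) u v = ∣ x - #X L + u ∣ + wordImbalance′ x (suc y) L u v

wordImbalance : List Bool → ℕ
wordImbalance L = wordImbalance′ 0 0 L 0 0

wordImbalance′-++ : ∀ x y P S u v →
  wordImbalance′ x y (P ++ S) u v ≡
  wordImbalance′ x y P (u + #X S) (v + #Y S) + wordImbalance′ (x + #X P) (y + #Y P) S u v
wordImbalance′-++ x y []          S u v =
  sym (cong₂ (λ x′ y′ → wordImbalance′ x′ y′ S u v) (+-identityʳ x) (+-identityʳ y))
wordImbalance′-++ x y (true  ∷ P) S u v =
  trans (cong₂ _+_ (cong ∣ y -_∣ (trans (cong (_+ v) (#Y-++ P S)) (xy∙z≈x∙zy (#Y P) (#Y S) v)))
                   (trans (wordImbalance′-++ (suc x) y P S u v)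
                          (cong (λ t → inP + wordImbalance′ t (y + #Y P) S u v) (sym (+-suc x (#X P))))))
        (sym (+-assoc ∣ y - #Y P + (v + #Y S) ∣ inP _))
  where inP : ℕ
        inP = wordImbalance′ (suc x) y P (u + #X S) (v + #Y S)
wordImbalance′-++ x y (false ∷ P) S u v =
  trans (cong₂ _+_ (cong ∣ x -_∣ (trans (cong (_+ u) (#X-++ P S)) (xy∙z≈x∙zy (#X P) (#X S) u)))
                   (trans (wordImbalance′-++ x (suc y) P S u v)
                          (cong (λ t → inP + wordImbalance′ (x + #X P) t S u v) (sym (+-suc y (#Y P))))))
        (sym (+-assoc ∣ x - #X P + (u + #X S) ∣ inP _))
  where inP : ℕ
        inP = wordImbalance′ x (suc y) P (u + #X S) (v + #Y S)

-- Lower bound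

∣m+n-o+p∣≤∣m-o∣+∣n-p∣ : ∀ m n o p → ∣ m + n - o + p ∣ ≤ ∣ m - o ∣ + ∣ n - p ∣
∣m+n-o+p∣≤∣m-o∣+∣n-p∣ m n o p = begin
  ∣ m + n - o + p ∣
    ≤⟨ ∣-∣-triangle (m + n) (o + n) (o + p) ⟩
  ∣ m + n - o + n ∣ + ∣ o + n - o + p ∣
    ≡⟨ cong₂ _+_ (trans (cong₂ ∣_-_∣ (+-comm m n) (+-comm o n)) (∣m+n-m+o∣≡∣n-o∣ n m o))
                 (∣m+n-m+o∣≡∣n-o∣ o n p) ⟩
  ∣ m - o ∣ + ∣ n - p ∣ ∎
  where open ≤-Reasoning

∣m+n-o+p∣≤∣m-k+o∣+∣k+n-p∣ : ∀ m n o p k → ∣ m + n - o + p ∣ ≤ ∣ m - k + o ∣ + ∣ k + n - p ∣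
∣m+n-o+p∣≤∣m-k+o∣+∣k+n-p∣ m n o p k = begin
  ∣ m + n - o + p ∣             ≡⟨ ∣m+n-m+o∣≡∣n-o∣ k (m + n) (o + p) ⟨
  ∣ k + (m + n) - k + (o + p) ∣ ≡⟨ cong₂ ∣_-_∣ (x∙yz≈y∙xz k m n) (sym (+-assoc k o p)) ⟩
  ∣ m + (k + n) - k + o + p ∣   ≤⟨ ∣m+n-o+p∣≤∣m-o∣+∣n-p∣ m (k + n) (k + o) p ⟩
  ∣ m - k + o ∣ + ∣ k + n - p ∣ ∎
  where open ≤-Reasoning

-- crossings x y L counts the X–Y pairs with one vertex in L and the other
-- among x X's and y Y's.
crossings : ℕ → ℕ → List Bool → ℕ
crossings x y L = x * #Y L + y * #X L

crossings-true : ∀ x y L → crossings x y (true ∷ L) ≡ y + crossings x y L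
crossings-true x y L = trans (cong (x * #Y L +_) (*-suc y (#X L))) (x∙yz≈y∙xz (x * #Y L) y (y * #X L))

crossings-false : ∀ x y L → crossings x y (false ∷ L) ≡ x + crossings x y L
crossings-false x y L = trans (cong (_+ y * #X L) (*-suc x (#Y L))) (+-assoc x (x * #Y L) (y * #X L))

crossings-sucˡ : ∀ x y L → crossings (suc x) y L ≡ #Y L + crossings x y L
crossings-sucˡ x y L = +-assoc (#Y L) (x * #Y L) (y * #X L)

crossings-sucʳ : ∀ x y L → crossings x (suc y) L ≡ #X L + crossings x y L
crossings-sucʳ x y L = x∙yz≈y∙xz (x * #Y L) (#X L) (y * #X L)

∣crossings-crossings∣≤wordImbalance′ : ∀ x y L u v →
  ∣ crossings x y L - crossings u v L ∣ ≤ wordImbalance′ x y L u v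
∣crossings-crossings∣≤wordImbalance′ x y []          u v =
  ≤-reflexive (cong₂ ∣_-_∣ (crossings-[] x y) (crossings-[] u v))
  where crossings-[] : ∀ x y → crossings x y [] ≡ 0
        crossings-[] x y = cong₂ _+_ (*-zeroʳ x) (*-zeroʳ y)
∣crossings-crossings∣≤wordImbalance′ x y (true  ∷ L) u v = begin
  ∣ crossings x y (true ∷ L) - crossings u v (true ∷ L) ∣
    ≡⟨ cong₂ ∣_-_∣ (crossings-true x y L) (crossings-true u v L) ⟩
  ∣ y + crossings x y L - v + crossings u v L ∣
    ≤⟨ ∣m+n-o+p∣≤∣m-k+o∣+∣k+n-p∣ y _ v _ (#Y L) ⟩
  ∣ y - #Y L + v ∣ + ∣ #Y L + crossings x y L - crossings u v L ∣
    ≡⟨ cong (λ t → ∣ y - #Y L + v ∣ + ∣ t - crossings u v L ∣) (crossings-sucˡ x y L) ⟨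
  ∣ y - #Y L + v ∣ + ∣ crossings (suc x) y L - crossings u v L ∣
    ≤⟨ +-monoʳ-≤ ∣ y - #Y L + v ∣ (∣crossings-crossings∣≤wordImbalance′ (suc x) y L u v) ⟩
  ∣ y - #Y L + v ∣ + wordImbalance′ (suc x) y L u v ∎
  where open ≤-Reasoning
∣crossings-crossings∣≤wordImbalance′ x y (false ∷ L) u v = begin
  ∣ crossings x y (false ∷ L) - crossings u v (false ∷ L) ∣
    ≡⟨ cong₂ ∣_-_∣ (crossings-false x y L) (crossings-false u v L) ⟩
  ∣ x + crossings x y L - u + crossings u v L ∣
    ≤⟨ ∣m+n-o+p∣≤∣m-k+o∣+∣k+n-p∣ x _ u _ (#X L) ⟩
  ∣ x - #X L + u ∣ + ∣ #X L + crossings x y L - crossings u v L ∣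
    ≡⟨ cong (λ t → ∣ x - #X L + u ∣ + ∣ t - crossings u v L ∣) (crossings-sucʳ x y L) ⟨
  ∣ x - #X L + u ∣ + ∣ crossings x (suc y) L - crossings u v L ∣
    ≤⟨ +-monoʳ-≤ ∣ x - #X L + u ∣ (∣crossings-crossings∣≤wordImbalance′ x (suc y) L u v) ⟩
  ∣ x - #X L + u ∣ + wordImbalance′ x (suc y) L u v ∎
  where open ≤-Reasoning

crossings+crossings≤wordImbalance : ∀ P S →
  crossings (#X S) (#Y S) P + crossings (#X P) (#Y P) S ≤ wordImbalance (P ++ S)
crossings+crossings≤wordImbalance P S = begin
  crossings (#X S) (#Y S) P + crossings (#X P) (#Y P) S
    ≡⟨ cong (crossings (#X S) (#Y S) P +_) (∣-∣-identityʳ (crossings (#X P) (#Y P) S)) ⟨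
  ∣ 0 - crossings (#X S) (#Y S) P ∣ + ∣ crossings (#X P) (#Y P) S - 0 ∣
    ≤⟨ +-mono-≤ (∣crossings-crossings∣≤wordImbalance′ 0 0 P (#X S) (#Y S))
                (∣crossings-crossings∣≤wordImbalance′ (#X P) (#Y P) S 0 0) ⟩
  wordImbalance′ 0 0 P (#X S) (#Y S) + wordImbalance′ (#X P) (#Y P) S 0 0
    ≡⟨ wordImbalance′-++ 0 0 P S 0 0 ⟨
  wordImbalance (P ++ S) ∎
  where open ≤-Reasoning

splitAtX : ∀ L k → k < #X L → ∃₂ λ P S → L ≡ P ++ true ∷ S × #X P ≡ k
splitAtX (true  ∷ L) zero    _         = [] , L , refl , refl
splitAtX (true  ∷ L) (suc k) (s≤s k<n) with splitAtX L k k<n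
... | P , S , refl , refl = true ∷ P , S , refl , refl
splitAtX (false ∷ L) k       k<n       with splitAtX L k k<n
... | P , S , refl , refl = false ∷ P , S , refl , refl

parity : ∀ n → (∃ λ m → n ≡ m + m) ⊎ (∃ λ m → n ≡ suc (m + m))
parity zero    = inj₁ (0 , refl)
parity (suc n) with parity n
... | inj₁ (m , refl) = inj₂ (m , refl)
... | inj₂ (m , refl) = inj₁ (suc m , cong suc (sym (+-suc m m)))

halves-equal : ∀ {p s m} → p ≡ m → p + s ≡ m + m → p ≡ s
halves-equal refl e = sym (+-cancelˡ-≡ _ _ _ e)

data MedianCut : List Bool → Set where
  between : ∀ P S → #X P ≡ #X S → MedianCut (P ++ S)
  through : ∀ P S → #X P ≡ #X S → MedianCut (P ++ true ∷ S)

medianCut : ∀ L → MedianCut L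
medianCut L with parity (#X L)
... | inj₁ (zero , even) = between [] L (sym even)
... | inj₁ (suc m , even) with splitAtX L (suc m) (subst (suc m <_) (sym even) (m<n+m (suc m) z<s))
...   | P , S , refl , #P = between P (true ∷ S) (halves-equal #P (trans (sym (#X-++ P (true ∷ S))) even))
medianCut L | inj₂ (m , odd) with splitAtX L m (subst (m <_) (sym odd) (s≤s (m≤m+n m m)))
...   | P , S , refl , #P = through P S (halves-equal #P (suc-injective
          (trans (sym (+-suc (#X P) (#X S))) (trans (sym (#X-++ P (true ∷ S))) odd))))

optimum : ℕ → ℕ → ℕ
optimum a b = a * b + (a % 2) * (b % 2)

[m+m]%2≡0 : ∀ m → (m + m) % 2 ≡ 0
[m+m]%2≡0 zero    = refl
[m+m]%2≡0 (suc m) = trans (cong (λ k → suc k % 2) (+-suc m m)) ([m+m]%2≡0 m)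

[m+1+m]%2≡1 : ∀ m → (m + suc m) % 2 ≡ 1
[m+1+m]%2≡1 zero    = refl
[m+1+m]%2≡1 (suc m) = trans (cong (λ k → suc k % 2) (+-suc m (suc m))) ([m+1+m]%2≡1 m)

n+n%2≤1+n : ∀ n → n + n % 2 ≤ suc n
n+n%2≤1+n n = subst (n + n % 2 ≤_) (+-comm n 1) (+-monoʳ-≤ n (s≤s⁻¹ (m%n<n n 2)))

m+n+[m+n]%2≤2max : ∀ m n → m + n + (m + n) % 2 ≤ m + m ⊎ m + n + (m + n) % 2 ≤ n + n
m+n+[m+n]%2≤2max m n with <-cmp m n
... | tri< m<n _ _    = inj₂ (≤-trans (n+n%2≤1+n (m + n)) (+-monoˡ-≤ n m<n))
... | tri≈ _ refl _   = inj₁ (≤-reflexive (trans (cong (m + m +_) ([m+m]%2≡0 m)) (+-identityʳ (m + m))))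
... | tri> _ _ n<m    = inj₁ (≤-trans (n+n%2≤1+n (m + n))
                                       (subst (_≤ m + m) (+-suc m n) (+-monoʳ-≤ m n<m)))

optimum-between : ∀ a b b′ → optimum (a + a) (b + b′) ≡ (a * b + b′ * a) + (a * b′ + b * a)
optimum-between a b b′ rewrite [m+m]%2≡0 a = double a b b′
  where double : ∀ a b b′ → (a + a) * (b + b′) + 0 ≡ (a * b + b′ * a) + (a * b′ + b * a)
        double = solve-∀

optimum-through : ∀ a b b′ {w} →
  (suc a * b + b′ * a) + (a * b′ + b * suc a) ≤ w →
  (a * b + b′ * suc a) + (suc a * b′ + b * a) ≤ w →
  optimum (a + suc a) (b + b′) ≤ w
optimum-through a b b′ {w} left right = begin
  optimum (a + suc a) (b + b′)
    ≡⟨ cong (λ r → (a + suc a) * (b + b′) + r * ((b + b′) % 2)) ([m+1+m]%2≡1 a) ⟩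
  (a + suc a) * (b + b′) + 1 * ((b + b′) % 2)
    ≡⟨ odd a b b′ ((b + b′) % 2) ⟩
  B + (b + b′ + (b + b′) % 2)
    ≤⟨ [ (λ h → ≤-trans (+-monoʳ-≤ B h) (subst (_≤ w) (cutBefore a b b′) left))
       , (λ h → ≤-trans (+-monoʳ-≤ B h) (subst (_≤ w) (cutAfter a b b′) right))
       ]′ (m+n+[m+n]%2≤2max b b′) ⟩
  w ∎
  where
  open ≤-Reasoning
  B : ℕ
  B = (a + a) * (b + b′)
  odd : ∀ a b b′ r → (a + suc a) * (b + b′) + 1 * r ≡ (a + a) * (b + b′) + (b + b′ + r)
  odd = solve-∀
  cutBefore : ∀ a b b′ → (suc a * b + b′ * a) + (a * b′ + b * suc a) ≡ (a + a) * (b + b′) + (b + b)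
  cutBefore = solve-∀
  cutAfter : ∀ a b b′ → (a * b + b′ * suc a) + (suc a * b′ + b * a) ≡ (a + a) * (b + b′) + (b′ + b′)
  cutAfter = solve-∀

optimum≤wordImbalance : ∀ L → optimum (#X L) (#Y L) ≤ wordImbalance L
optimum≤wordImbalance L with medianCut L
... | between P S eq = begin
  optimum (#X (P ++ S)) (#Y (P ++ S))
    ≡⟨ cong₂ optimum (trans (#X-++ P S) (cong (_+ #X S) eq)) (#Y-++ P S) ⟩
  optimum (#X S + #X S) (#Y P + #Y S)
    ≡⟨ optimum-between (#X S) (#Y P) (#Y S) ⟩
  (#X S * #Y P + #Y S * #X S) + (#X S * #Y S + #Y P * #X S)
    ≡⟨ cong (λ p → (#X S * #Y P + #Y S * p) + (p * #Y S + #Y P * #X S)) (sym eq) ⟩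
  crossings (#X S) (#Y S) P + crossings (#X P) (#Y P) S
    ≤⟨ crossings+crossings≤wordImbalance P S ⟩
  wordImbalance (P ++ S) ∎
  where open ≤-Reasoning
... | through P S eq =
  subst₂ (λ a b → optimum a b ≤ w)
         (sym (trans (#X-++ P (true ∷ S)) (cong (_+ suc s) eq))) (sym (#Y-++ P (true ∷ S)))
         (optimum-through s bP bS cutBefore cutAfter)
  where
  open ≤-Reasoning
  s bP bS w : ℕ
  s = #X S
  bP = #Y P
  bS = #Y S
  w = wordImbalance (P ++ true ∷ S)
  cutBefore : (suc s * bP + bS * s) + (s * bS + bP * suc s) ≤ w
  cutBefore = begin
    (suc s * bP + bS * s) + (s * bS + bP * suc s)
      ≡⟨ cong (λ p → (suc s * bP + bS * p) + (p * bS + bP * suc s)) (sym eq) ⟩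
    crossings (#X (true ∷ S)) bS P + crossings (#X P) bP (true ∷ S)
      ≤⟨ crossings+crossings≤wordImbalance P (true ∷ S) ⟩
    w ∎
  cutAfter : (s * bP + bS * suc s) + (suc s * bS + bP * s) ≤ w
  cutAfter = begin
    (s * bP + bS * suc s) + (suc s * bS + bP * s)
      ≡⟨ cong₂ (λ x y → (s * y + bS * x) + (x * bS + y * s))
               (sym (trans (#X-∷ʳ-true P) (cong suc eq))) (sym (#Y-∷ʳ-true P)) ⟩
    crossings s bS (P ++ [ true ]) + crossings (#X (P ++ [ true ])) (#Y (P ++ [ true ])) S
      ≤⟨ crossings+crossings≤wordImbalance (P ++ [ true ]) S ⟩
    wordImbalance ((P ++ [ true ]) ++ S)
      ≡⟨ cong wordImbalance (++-assoc P [ true ] S) ⟩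
    w ∎

-- Balanced words

wordImbalance′-sucˣ : ∀ x y L u v → wordImbalance′ (suc x) y L (suc u) v ≡ wordImbalance′ x y L u v
wordImbalance′-sucˣ x y []          u v = refl
wordImbalance′-sucˣ x y (true  ∷ L) u v = cong (∣ y - #Y L + v ∣ +_) (wordImbalance′-sucˣ (suc x) y L u v)
wordImbalance′-sucˣ x y (false ∷ L) u v =
  cong₂ _+_ (cong ∣ suc x -_∣ (+-suc (#X L) u)) (wordImbalance′-sucˣ x (suc y) L u v)

wordImbalance′-sucʸ : ∀ x y L u v → wordImbalance′ x (suc y) L u (suc v) ≡ wordImbalance′ x y L u v
wordImbalance′-sucʸ x y []          u v = refl
wordImbalance′-sucʸ x y (true  ∷ L) u v =
  cong₂ _+_ (cong ∣ suc y -_∣ (+-suc (#Y L) v)) (wordImbalance′-sucʸ (suc x) y L u v)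
wordImbalance′-sucʸ x y (false ∷ L) u v = cong (∣ x - #X L + u ∣ +_) (wordImbalance′-sucʸ x (suc y) L u v)

-- Wrapping a word in two new X's leaves every old vertex balanced as before
-- (a Y vertex gains one X on each side) and each new X sees all the Y's on one side.
wordImbalance-wrapX : ∀ L → wordImbalance (true ∷ L ++ [ true ]) ≡ #Y L + (wordImbalance L + #Y L)
wordImbalance-wrapX L =
  cong₂ _+_ (trans (+-identityʳ _) (#Y-∷ʳ-true L))
            (trans (wordImbalance′-++ 1 0 L [ true ] 0 0)
                   (cong₂ _+_ (wordImbalance′-sucˣ 0 0 L 0 0) (trans (+-identityʳ _) (∣-∣-identityʳ (#Y L)))))

wordImbalance-wrapY : ∀ L → wordImbalance (false ∷ L ++ [ false ]) ≡ #X L + (wordImbalance L + #X L)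
wordImbalance-wrapY L =
  cong₂ _+_ (trans (+-identityʳ _) (#X-∷ʳ-false L))
            (trans (wordImbalance′-++ 0 1 L [ false ] 0 0)
                   (cong₂ _+_ (wordImbalance′-sucʸ 0 0 L 0 0) (trans (+-identityʳ _) (∣-∣-identityʳ (#X L)))))

-- X^⌊a/2⌋ Y^⌊b/2⌋ X^(a mod 2) Y^(b mod 2) Y^⌊b/2⌋ X^⌊a/2⌋
balancedWord : ℕ → ℕ → List Bool
balancedWord (suc (suc a)) b             = true ∷ balancedWord a b ++ [ true ]
balancedWord 0             (suc (suc b)) = false ∷ balancedWord 0 b ++ [ false ]
balancedWord 1             (suc (suc b)) = false ∷ balancedWord 1 b ++ [ false ]
balancedWord 0             0             = []
balancedWord 0             1             = false ∷ []
balancedWord 1             0             = true ∷ []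
balancedWord 1             1             = true ∷ false ∷ []

#X-balancedWord : ∀ a b → #X (balancedWord a b) ≡ a
#X-balancedWord (suc (suc a)) b = cong suc (trans (#X-∷ʳ-true (balancedWord a b)) (cong suc (#X-balancedWord a b)))
#X-balancedWord 0 (suc (suc b)) = trans (#X-∷ʳ-false (balancedWord 0 b)) (#X-balancedWord 0 b)
#X-balancedWord 1 (suc (suc b)) = trans (#X-∷ʳ-false (balancedWord 1 b)) (#X-balancedWord 1 b)
#X-balancedWord 0 0 = refl
#X-balancedWord 0 1 = refl
#X-balancedWord 1 0 = refl
#X-balancedWord 1 1 = refl

#Y-balancedWord : ∀ a b → #Y (balancedWord a b) ≡ b
#Y-balancedWord (suc (suc a)) b = trans (#Y-∷ʳ-true (balancedWord a b)) (#Y-balancedWord a b)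
#Y-balancedWord 0 (suc (suc b)) = cong suc (trans (#Y-∷ʳ-false (balancedWord 0 b)) (cong suc (#Y-balancedWord 0 b)))
#Y-balancedWord 1 (suc (suc b)) = cong suc (trans (#Y-∷ʳ-false (balancedWord 1 b)) (cong suc (#Y-balancedWord 1 b)))
#Y-balancedWord 0 0 = refl
#Y-balancedWord 0 1 = refl
#Y-balancedWord 1 0 = refl
#Y-balancedWord 1 1 = refl

wordImbalance-wrapX-optimum : ∀ a b L → #Y L ≡ b → wordImbalance L ≡ optimum a b →
  wordImbalance (true ∷ L ++ [ true ]) ≡ optimum (2 + a) b
wordImbalance-wrapX-optimum a _ L refl eq =
  trans (wordImbalance-wrapX L) (trans (cong (λ w → #Y L + (w + #Y L)) eq) (wrap a (#Y L) _))
  where wrap : ∀ a b t → b + ((a * b + t) + b) ≡ (2 + a) * b + t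
        wrap = solve-∀

wordImbalance-wrapY-optimum : ∀ a b L → #X L ≡ a → wordImbalance L ≡ optimum a b →
  wordImbalance (false ∷ L ++ [ false ]) ≡ optimum a (2 + b)
wordImbalance-wrapY-optimum _ b L refl eq =
  trans (wordImbalance-wrapY L) (trans (cong (λ w → #X L + (w + #X L)) eq) (wrap (#X L) b _))
  where wrap : ∀ a b t → a + ((a * b + t) + a) ≡ a * (2 + b) + t
        wrap = solve-∀

wordImbalance-balancedWord : ∀ a b → wordImbalance (balancedWord a b) ≡ optimum a b
wordImbalance-balancedWord (suc (suc a)) b =
  wordImbalance-wrapX-optimum a b (balancedWord a b) (#Y-balancedWord a b) (wordImbalance-balancedWord a b)
wordImbalance-balancedWord 0 (suc (suc b)) =
  wordImbalance-wrapY-optimum 0 b (balancedWord 0 b) (#X-balancedWord 0 b) (wordImbalance-balancedWord 0 b)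
wordImbalance-balancedWord 1 (suc (suc b)) =
  wordImbalance-wrapY-optimum 1 b (balancedWord 1 b) (#X-balancedWord 1 b) (wordImbalance-balancedWord 1 b)
wordImbalance-balancedWord 0 0 = refl
wordImbalance-balancedWord 0 1 = refl
wordImbalance-balancedWord 1 0 = refl
wordImbalance-balancedWord 1 1 = refl

-- From positions to words

𝟙 : Bool → ℕ
𝟙 true  = 1
𝟙 false = 0

opposite : Bool → ℕ → ℕ → ℕ
opposite true  x y = y
opposite false x y = x

#opp : Bool → List Bool → ℕ
#opp true  = #Y
#opp false = #X

+-opposite-0 : ∀ c m → m + opposite c 0 0 ≡ m
+-opposite-0 true  m = +-identityʳ m
+-opposite-0 false m = +-identityʳ m

wordImbalance′-∷ : ∀ c x y L u v → wordImbalance′ x y (c ∷ L) u v ≡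
  ∣ opposite c x y - #opp c L + opposite c u v ∣ + wordImbalance′ (𝟙 c + x) (𝟙 (not c) + y) L u v
wordImbalance′-∷ true  x y L u v = refl
wordImbalance′-∷ false x y L u v = refl

opposite-∷ : ∀ d c x y e → 𝟙 (d xor c) + e + opposite d x y ≡ e + opposite d (𝟙 c + x) (𝟙 (not c) + y)
opposite-∷ true  true  x y e = refl
opposite-∷ true  false x y e = sym (+-suc e y)
opposite-∷ false true  x y e = sym (+-suc e x)
opposite-∷ false false x y e = refl

∑-xor≡#opp : ∀ {n} c (w : Fin n → Bool) → ∑[ i < n ] 𝟙 (c xor w i) ≡ #opp c (tabulate w)
∑-xor≡#opp {zero}  true  w = refl
∑-xor≡#opp {zero}  false w = refl
∑-xor≡#opp {suc n} c w with w zero | ∑-xor≡#opp c (w ∘ suc)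
∑-xor≡#opp {suc n} true  w | true  | ih = ih
∑-xor≡#opp {suc n} true  w | false | ih = cong suc ih
∑-xor≡#opp {suc n} false w | true  | ih = cong suc ih
∑-xor≡#opp {suc n} false w | false | ih = ih

module _ {n : ℕ} (w : Fin n → Bool) where

  precedingOpposite followingOpposite : Fin n → ℕ
  precedingOpposite i = ∑[ j < n ] 𝟙 (⌊ j <? i ⌋ ∧ (w i xor w j))
  followingOpposite i = ∑[ j < n ] 𝟙 (⌊ i <? j ⌋ ∧ (w i xor w j))

  -- The imbalance of the word i ↦ w i, in a frame as for wordImbalance′.
  positionalImbalance′ : ℕ → ℕ → ℕ → ℕ → ℕ
  positionalImbalance′ x y u v =
    ∑[ i < n ] ∣ precedingOpposite i + opposite (w i) x y - followingOpposite i + opposite (w i) u v ∣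

⌊suc<?suc⌋ : ∀ {n} (i j : Fin n) → ⌊ suc i <? suc j ⌋ ≡ ⌊ i <? j ⌋
⌊suc<?suc⌋ i j with i <? j | suc i <? suc j
... | yes _   | yes _   = refl
... | no  _   | no  _   = refl
... | yes i<j | no  i≮j = contradiction (s<s i<j) i≮j
... | no  i≮j | yes i<j = contradiction (s<s⁻¹ i<j) i≮j

module _ {n : ℕ} (w : Fin (suc n) → Bool) where

  precedingOpposite-zero : precedingOpposite w zero ≡ 0
  precedingOpposite-zero = sum-replicate-zero (suc n)

  followingOpposite-zero : followingOpposite w zero ≡ #opp (w zero) (tabulate (w ∘ suc))
  followingOpposite-zero = ∑-xor≡#opp (w zero) (w ∘ suc)

  precedingOpposite-suc : ∀ k →
    precedingOpposite w (suc k) ≡ 𝟙 (w (suc k) xor w zero) + precedingOpposite (w ∘ suc) k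
  precedingOpposite-suc k = cong (𝟙 (w (suc k) xor w zero) +_)
    (sum-cong-≗ λ j → cong (λ b → 𝟙 (b ∧ (w (suc k) xor w (suc j)))) (⌊suc<?suc⌋ j k))

  followingOpposite-suc : ∀ k → followingOpposite w (suc k) ≡ followingOpposite (w ∘ suc) k
  followingOpposite-suc k =
    sum-cong-≗ λ j → cong (λ b → 𝟙 (b ∧ (w (suc k) xor w (suc j)))) (⌊suc<?suc⌋ k j)

positionalImbalance′≡wordImbalance′ : ∀ {n} (w : Fin n → Bool) x y u v →
  positionalImbalance′ w x y u v ≡ wordImbalance′ x y (tabulate w) u v
positionalImbalance′≡wordImbalance′ {zero}  w x y u v = refl
positionalImbalance′≡wordImbalance′ {suc n} w x y u v = begin
  positionalImbalance′ w x y u v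
    ≡⟨ cong₂ _+_ (cong₂ (λ p f → ∣ p + opposite c x y - f + opposite c u v ∣)
                        (precedingOpposite-zero w) (followingOpposite-zero w))
                 (sum-cong-≗ λ k → cong₂ (λ p f → ∣ p - f + opposite (w (suc k)) u v ∣)
                        (trans (cong (_+ opposite (w (suc k)) x y) (precedingOpposite-suc w k))
                               (opposite-∷ (w (suc k)) c x y (precedingOpposite (w ∘ suc) k)))
                        (followingOpposite-suc w k)) ⟩
  ∣ opposite c x y - #opp c (tabulate (w ∘ suc)) + opposite c u v ∣ + positionalImbalance′ (w ∘ suc) x′ y′ u v
    ≡⟨ cong (∣ opposite c x y - #opp c (tabulate (w ∘ suc)) + opposite c u v ∣ +_)
            (positionalImbalance′≡wordImbalance′ (w ∘ suc) x′ y′ u v) ⟩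
  ∣ opposite c x y - #opp c (tabulate (w ∘ suc)) + opposite c u v ∣ + wordImbalance′ x′ y′ (tabulate (w ∘ suc)) u v
    ≡⟨ wordImbalance′-∷ c x y (tabulate (w ∘ suc)) u v ⟨
  wordImbalance′ x y (tabulate w) u v ∎
  where open ≡-Reasoning
        c : Bool
        c = w zero
        x′ y′ : ℕ
        x′ = 𝟙 c + x
        y′ = 𝟙 (not c) + y

-- Orderings of a complete bipartite graph

countFin≡∑ : ∀ {n} (p : Fin n → Bool) → countFin p ≡ ∑[ i < n ] 𝟙 (p i)
countFin≡∑ {n} p = go (λ i → i)
  where
  go : ∀ {m} (g : Fin m → Fin n) →
       length (filter (λ v → p v Bool.≟ true) (tabulate g)) ≡ ∑[ i < m ] 𝟙 (p (g i))
  go {zero}  g = refl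
  go {suc m} g with p (g zero)
  ... | true  = cong suc (go (g ∘ suc))
  ... | false = go (g ∘ suc)

sum-map-tabulate : ∀ {n} {A : Set} (f : A → ℕ) (g : Fin n → A) →
  ListAction.sum (map f (tabulate g)) ≡ ∑[ i < n ] f (g i)
sum-map-tabulate {zero}  f g = refl
sum-map-tabulate {suc n} f g = cong (f (g zero) +_) (sum-map-tabulate f (g ∘ suc))

tabulate-lookup-cast : ∀ (L : List Bool) {m} (e : m ≡ length L) → tabulate (λ i → lookup L (cast e i)) ≡ L
tabulate-lookup-cast []      {zero}  e = refl
tabulate-lookup-cast (c ∷ L) {suc m} e = cong (c ∷_) (tabulate-lookup-cast L (cong pred e))

∑-𝟙-witness : ∀ {n} (h : Fin n → Bool) {k} → ∑[ i < n ] 𝟙 (h i) ≡ suc k → ∃ λ i → h i ≡ true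
∑-𝟙-witness {suc n} h eq with h zero in h₀
... | true  = zero , h₀
... | false = let i , hᵢ = ∑-𝟙-witness (h ∘ suc) eq in suc i , hᵢ

not-xor≡true : ∀ c b → not c xor b ≡ true → b ≡ c
not-xor≡true true  true  _ = refl
not-xor≡true false false _ = refl

not-xor-self : ∀ c → not c xor c ≡ true
not-xor-self true  = refl
not-xor-self false = refl

-- Send position 0 to some j with f j ≡ g 0 and recurse on the remaining positions.
∃-permutation : ∀ {n} (f g : Fin n → Bool) →
  (∀ c → ∑[ i < n ] 𝟙 (c xor f i) ≡ ∑[ i < n ] 𝟙 (c xor g i)) →
  ∃ λ (π : Permutation′ n) → ∀ i → g i ≡ f (π ⟨$⟩ʳ i)
∃-permutation {zero}  f g same = idₚ , λ ()
∃-permutation {suc n} f g same = insert zero j ρ , matches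
  where
  c₀ : Bool
  c₀ = g zero
  found : ∃ λ j → not c₀ xor f j ≡ true
  found = ∑-𝟙-witness (λ i → not c₀ xor f i)
    (trans (same (not c₀)) (cong (λ b → 𝟙 b + ∑[ k < n ] 𝟙 (not c₀ xor g (suc k))) (not-xor-self c₀)))
  j : Fin (suc n)
  j = proj₁ found
  fⱼ : f j ≡ c₀
  fⱼ = not-xor≡true c₀ (f j) (proj₂ found)
  rest : ∀ c → ∑[ k < n ] 𝟙 (c xor f (punchIn j k)) ≡ ∑[ k < n ] 𝟙 (c xor g (suc k))
  rest c = +-cancelˡ-≡ (𝟙 (c xor c₀)) _ _ (begin
    𝟙 (c xor c₀) + others   ≡⟨ cong (λ b → 𝟙 (c xor b) + others) fⱼ ⟨
    𝟙 (c xor f j) + others  ≡⟨ sum-remove (λ i → 𝟙 (c xor f i)) ⟨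
    ∑[ i < suc n ] 𝟙 (c xor f i) ≡⟨ same c ⟩
    ∑[ i < suc n ] 𝟙 (c xor g i) ∎)
    where open ≡-Reasoning
          others : ℕ
          others = ∑[ k < n ] 𝟙 (c xor f (punchIn j k))
  sub : ∃ λ (ρ : Permutation′ n) → ∀ k → g (suc k) ≡ f (punchIn j (ρ ⟨$⟩ʳ k))
  sub = ∃-permutation (f ∘ punchIn j) (g ∘ suc) rest
  ρ : Permutation′ n
  ρ = proj₁ sub
  matches : ∀ i → g i ≡ f (insert zero j ρ ⟨$⟩ʳ i)
  matches zero    = sym fⱼ
  matches (suc k) = trans (proj₂ sub k) (cong f (sym (insert-punchIn zero j ρ k)))

module _ {n : ℕ} (inX : Fin n → Bool) where

  sideSequence : Ordering n → Fin n → Bool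
  sideSequence σ i = inX (σ ⟨$⟩ˡ i)

  countFin≡∑∘σ⁻¹ : ∀ (σ : Ordering n) (p : Fin n → Bool) → countFin p ≡ ∑[ i < n ] 𝟙 (p (σ ⟨$⟩ˡ i))
  countFin≡∑∘σ⁻¹ σ p = trans (countFin≡∑ p) (∑-permute (λ v → 𝟙 (p v)) (flip σ))

  countFin-xor≡#opp : ∀ σ c → countFin (λ v → c xor inX v) ≡ #opp c (tabulate (sideSequence σ))
  countFin-xor≡#opp σ c = trans (countFin≡∑∘σ⁻¹ σ (λ v → c xor inX v)) (∑-xor≡#opp c (sideSequence σ))

  ∃-ordering : ∀ L → (∀ c → countFin (λ v → c xor inX v) ≡ #opp c L) →
               ∃ λ σ → tabulate (sideSequence σ) ≡ L
  ∃-ordering L counts = flip π , trans (tabulate-cong (λ i → sym (matches i))) tabulate-g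
    where
    n≡length : n ≡ length L
    n≡length = begin
      n                                     ≡⟨ length-tabulate inX ⟨
      length (tabulate inX)                 ≡⟨ length≡#X+#Y (tabulate inX) ⟩
      #X (tabulate inX) + #Y (tabulate inX) ≡⟨ cong₂ _+_ (count false) (count true) ⟩
      #X L + #Y L                           ≡⟨ length≡#X+#Y L ⟨
      length L                              ∎
      where open ≡-Reasoning
            count : ∀ c → #opp c (tabulate inX) ≡ #opp c L
            count c = trans (sym (countFin-xor≡#opp idₚ c)) (counts c)
    g : Fin n → Bool
    g i = lookup L (cast n≡length i)
    tabulate-g : tabulate g ≡ L
    tabulate-g = tabulate-lookup-cast L n≡length
    sameCounts : ∀ c → ∑[ i < n ] 𝟙 (c xor inX i) ≡ ∑[ i < n ] 𝟙 (c xor g i)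
    sameCounts c = begin
      ∑[ i < n ] 𝟙 (c xor inX i)   ≡⟨ countFin≡∑ (λ v → c xor inX v) ⟨
      countFin (λ v → c xor inX v) ≡⟨ counts c ⟩
      #opp c L                     ≡⟨ cong (#opp c) tabulate-g ⟨
      #opp c (tabulate g)          ≡⟨ ∑-xor≡#opp c g ⟨
      ∑[ i < n ] 𝟙 (c xor g i)     ∎
      where open ≡-Reasoning
    permutation : ∃ λ (π : Permutation′ n) → ∀ i → g i ≡ inX (π ⟨$⟩ʳ i)
    permutation = ∃-permutation inX g sameCounts
    π : Permutation′ n
    π = proj₁ permutation
    matches : ∀ i → g i ≡ inX (π ⟨$⟩ʳ i)
    matches = proj₂ permutation

module _ {n : ℕ} (G : Graph n) (inX : Fin n → Bool) (bipartite : IsCompleteBipartite G inX) where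

  Adj≡xor : ∀ u v → Adj G u v ≡ inX u xor inX v
  Adj≡xor u v with inX u | inX v | proj₁ bipartite u v | proj₂ bipartite u v
  ... | true  | true  | separated | _        = ¬-not (λ adj → separated adj refl)
  ... | false | false | separated | _        = ¬-not (λ adj → separated adj refl)
  ... | true  | false | _         | complete = complete (λ ())
  ... | false | true  | _         | complete = complete (λ ())

  module _ (σ : Ordering n) where

    side : Fin n → Bool
    side = sideSequence inX σ

    opposite-neighbours : ∀ i (R : Fin n → Bool) →
      countFin (λ u → Adj G (σ ⟨$⟩ˡ i) u ∧ R (σ ⟨$⟩ʳ u)) ≡ ∑[ j < n ] 𝟙 (R j ∧ (side i xor side j))
    opposite-neighbours i R = trans (countFin≡∑∘σ⁻¹ inX σ _) (sum-cong-≗ λ j → cong 𝟙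
      (trans (cong₂ _∧_ (Adj≡xor (σ ⟨$⟩ˡ i) (σ ⟨$⟩ˡ j)) (cong R (inverseʳ σ)))
             (∧-comm (side i xor side j) (R j))))

    before≡precedingOpposite : ∀ i → before G σ (σ ⟨$⟩ˡ i) ≡ precedingOpposite side i
    before≡precedingOpposite i = trans (opposite-neighbours i (λ j → ⌊ j <? σ ⟨$⟩ʳ (σ ⟨$⟩ˡ i) ⌋))
      (sum-cong-≗ λ j → cong (λ k → 𝟙 (⌊ j <? k ⌋ ∧ (side i xor side j))) (inverseʳ σ))

    after≡followingOpposite : ∀ i → after G σ (σ ⟨$⟩ˡ i) ≡ followingOpposite side i
    after≡followingOpposite i = trans (opposite-neighbours i (λ j → ⌊ σ ⟨$⟩ʳ (σ ⟨$⟩ˡ i) <? j ⌋))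
      (sum-cong-≗ λ j → cong (λ k → 𝟙 (⌊ k <? j ⌋ ∧ (side i xor side j))) (inverseʳ σ))

    imbalance≡wordImbalance : imbalance G σ ≡ wordImbalance (tabulate side)
    imbalance≡wordImbalance = begin
      imbalance G σ
        ≡⟨ sum-map-tabulate (vertexImbalance G σ) (λ v → v) ⟩
      ∑[ v < n ] vertexImbalance G σ v
        ≡⟨ ∑-permute (vertexImbalance G σ) (flip σ) ⟩
      ∑[ i < n ] ∣ before G σ (σ ⟨$⟩ˡ i) - after G σ (σ ⟨$⟩ˡ i) ∣
        ≡⟨ sum-cong-≗ (λ i → cong₂ ∣_-_∣
             (trans (before≡precedingOpposite i) (sym (+-opposite-0 (side i) _)))
             (trans (after≡followingOpposite i) (sym (+-opposite-0 (side i) _)))) ⟩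
      positionalImbalance′ side 0 0 0 0
        ≡⟨ positionalImbalance′≡wordImbalance′ side 0 0 0 0 ⟩
      wordImbalance (tabulate side) ∎
      where open ≡-Reasoning

theorem1 : ∀ (n : ℕ) (G : Graph n) (inX : Fin n → Bool) →
    Connected G →
    IsCompleteBipartite G inX →
    MinImbalance G (countFin inX * countFin (λ v → not (inX v))
                    + (countFin inX % 2) * (countFin (λ v → not (inX v)) % 2))
theorem1 n G inX _ bipartite = (σ , attained) , bound
  where
  a b : ℕ
  a = countFin inX
  b = countFin (λ v → not (inX v))
  bound : ∀ σ → optimum a b ≤ imbalance G σ
  bound σ = begin
    optimum a b
      ≡⟨ cong₂ optimum (countFin-xor≡#opp inX σ false) (countFin-xor≡#opp inX σ true) ⟩
    optimum (#X word) (#Y word)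
      ≤⟨ optimum≤wordImbalance word ⟩
    wordImbalance word
      ≡⟨ imbalance≡wordImbalance G inX bipartite σ ⟨
    imbalance G σ ∎
    where open ≤-Reasoning
          word : List Bool
          word = tabulate (sideSequence inX σ)
  counts : ∀ c → countFin (λ v → c xor inX v) ≡ #opp c (balancedWord a b)
  counts false = sym (#X-balancedWord a b)
  counts true  = sym (#Y-balancedWord a b)
  ordering : ∃ λ σ → tabulate (sideSequence inX σ) ≡ balancedWord a b
  ordering = ∃-ordering inX (balancedWord a b) counts
  σ : Ordering n
  σ = proj₁ ordering
  attained : imbalance G σ ≡ optimum a b
  attained = begin
    imbalance G σ                          ≡⟨ imbalance≡wordImbalance G inX bipartite σ ⟩
    wordImbalance (tabulate (sideSequence inX σ)) ≡⟨ cong wordImbalance (proj₂ ordering) ⟩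
    wordImbalance (balancedWord a b)       ≡⟨ wordImbalance-balancedWord a b ⟩
    optimum a b                            ∎
    where open ≡-Reasoning
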